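{- For every integer $d\ge0$: (a) $F_{d,n}(x)=F_{d,n-1}(x)+K_{d,n}(x)$ for $n\ge1$; (b) $F_{d,n}(x)=K_{d,0}(x)+K_{d,1}(x)+\dots+K_{d,n}(x)$ for $n\ge0$.
   Context: Fibonacci polynomials: $F_{d,n}(x)=1$ for integers $n<d$ and $F_{d,n}(x)=F_{d,n-1}(x)+xF_{d,n-d}(x)$ for $n\ge d$ (for $d=0$ this defines the formal power series $F_{0,n}(x)=(1-x)^{ -(n+1)}$). For integers $n\ge0$, $K_{d,n}(x)=\sum_\mu x^{\ell(\mu)}$, summing over all integer compositions $\mu$ of $n$ all of whose parts have size at least $d$, with $\ell(\mu)$ the number of parts (when $d=0$ parts of size $0$ are allowed, giving a formal power series in $x$). -}

module Defs where

open import Data.Bool using (Bool; true; false)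
open import Data.Nat using (ℕ; zero; suc; _+_; _∸_; _≤_; _<ᵇ_)
open import Data.List using (List; length)
open import Data.Nat.ListAction using (sum)
open import Data.List.Relation.Unary.All using (All)
open import Data.Product using (Σ; _×_; proj₁)
open import Relation.Binary.PropositionalEquality using (_≡_)

-- Formal power series in x with ℕ coefficients, as coefficient functions:
-- a k = coefficient of x^k.  (Polynomials are the finitely supported ones.)
PowerSeries : Set
PowerSeries = ℕ → ℕ

-- Coefficients of the Fibonacci polynomials F_{d,n}(x).
-- fibCoef d n k = [x^k] F_{d,n}(x), computed from
--   F_{d,n} = 1                       if n < d
--   F_{d,n} = F_{d,n-1} + x F_{d,n-d}  if n ≥ d
-- (with F_{d,-1} = 1, since -1 < d).  For d = 0 the recursion
-- F_{0,n} = F_{0,n-1} + x F_{0,n} is well-founded on coefficients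
-- ([x^k] on the right uses [x^(k-1)] F_{0,n}) and yields (1-x)^{-(n+1)}.
mutual
  fibCoef : ℕ → ℕ → ℕ → ℕ
  fibCoef d n k = fibStep d n k (n <ᵇ d)

  fibStep : ℕ → ℕ → ℕ → Bool → ℕ
  fibStep d n zero    true  = 1
  fibStep d n (suc k) true  = 0
  -- n ≥ d, n = 0 : F_{d,-1} = 1 contributes [k = 0]
  fibStep d zero    zero    false = 1
  fibStep d zero    (suc k) false = fibCoef d (zero ∸ d) k
  fibStep d (suc m) zero    false = fibCoef d m zero
  fibStep d (suc m) (suc k) false = fibCoef d m (suc k) + fibCoef d (suc m ∸ d) k

F : ℕ → ℕ → PowerSeries
F d n = fibCoef d n

IsComposition : ℕ → ℕ → List ℕ → Set
IsComposition d n μ = All (d ≤_) μ × sum μ ≡ n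

Composition : ℕ → ℕ → Set
Composition d n = Σ (List ℕ) (IsComposition d n)

-- Compositions contributing to the coefficient of x^k in
-- K_{d,n}(x) = Σ_μ x^{ℓ(μ)}, i.e. those with exactly k parts.
-- [x^k] K_{d,n}(x) is the cardinality of this (finite) type.
KTerm : ℕ → ℕ → ℕ → Set
KTerm d n k = Σ (Composition d n) (λ μ → length (proj₁ μ) ≡ k)

{-# OPTIONS --safe #-}
-- Splitting off the first part p ≥ d of a composition of m with k + 1 parts leaves a composition
-- of the remainder m − p ∈ [0, m − d] with k parts, so [x^(k+1)] K_{d,m} = Σ_{r ≤ m−d} [x^k] K_{d,r}.
-- By (b) for x^k this is [x^k] F_{d,m−d}, the contribution of x F_{d,n+1−d} to F_{d,n+1} when
-- m = n + 1 ≥ d; this gives (a) for x^(k+1), while for x^0 and for n + 1 < d both increments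
-- vanish. Summing (a) over n gives (b), so (a) and (b) follow by joint induction on k.
module Submission where

open import Defs
open import Data.Nat using (ℕ; suc)
open import Data.Fin using (Fin; toℕ)
open import Data.Sum using (_⊎_)
open import Data.Product using (Σ; _×_)
open import Function.Bundles using (_↔_)

open import Data.Bool using (true; false)
open import Data.Empty using (⊥-elim)
open import Data.Fin as Fin using (fromℕ<)
open import Data.Fin.Properties using (+↔⊎; toℕ-fromℕ<; toℕ-injective; toℕ<n)
open import Data.List using (List; []; _∷_)
import Data.List.Relation.Unary.All as All
open import Data.Nat using (zero; _+_; _∸_; _≤_; _<_; _<ᵇ_; _≤?_; s≤s; z≤n)
open import Data.Nat.ListAction using (sum)
open import Data.Nat.Properties
open import Data.Product using (_,_; proj₁)
open import Data.Sum using (inj₁; inj₂; [_,_])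
open import Data.Sum.Algebra using (⊎-assoc; ⊎-comm)
open import Data.Sum.Function.Propositional using (_⊎-↔_)
open import Function.Base using (id; _∘_)
open import Function.Bundles using (mk↔ₛ′)
open import Function.Properties.Inverse using (↔-refl)
open import Function.Related.Propositional as Related using (bijection)
open import Level using (0ℓ)
open import Relation.Binary.PropositionalEquality using (_≡_; refl; sym; trans; cong; subst)
open import Relation.Nullary.Decidable using (yes; no)
open import Relation.Nullary.Negation using (¬_)
open import Relation.Nullary.Reflects using (ofʸ; ofⁿ; det)

open Related.EquationalReasoning {k = bijection}

private
  variable
    A B : Set
    d m n k : ℕ

⊎-identityʳ-¬ : ¬ B → (A ⊎ B) ↔ A
⊎-identityʳ-¬ ¬b = mk↔ₛ′ [ id , ⊥-elim ∘ ¬b ] inj₁ (λ _ → refl) [ (λ _ → refl) , ⊥-elim ∘ ¬b ]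

empty↔empty : ¬ A → ¬ B → A ↔ B
empty↔empty ¬a ¬b = mk↔ₛ′ (⊥-elim ∘ ¬a) (⊥-elim ∘ ¬b) (⊥-elim ∘ ¬b) (⊥-elim ∘ ¬a)

Σ-Fin-1↔ : (Q : ℕ → Set) → Σ (Fin 1) (λ i → Q (toℕ i)) ↔ Q 0
Σ-Fin-1↔ Q = mk↔ₛ′ (λ { (Fin.zero , q) → q ; (Fin.suc () , _) }) (Fin.zero ,_) (λ _ → refl)
  (λ { (Fin.zero , q) → refl ; (Fin.suc () , _) })

Σ-Fin-suc↔⊎ˡ : (Q : ℕ → Set) → Σ (Fin (suc n)) (λ i → Q (toℕ i)) ↔ (Q 0 ⊎ Σ (Fin n) (λ i → Q (suc (toℕ i))))
Σ-Fin-suc↔⊎ˡ Q = mk↔ₛ′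
  (λ { (Fin.zero , q) → inj₁ q ; (Fin.suc i , q) → inj₂ (i , q) })
  [ (Fin.zero ,_) , (λ { (i , q) → Fin.suc i , q }) ]
  [ (λ _ → refl) , (λ _ → refl) ]
  (λ { (Fin.zero , q) → refl ; (Fin.suc i , q) → refl })

Σ-Fin-suc↔⊎ʳ : ∀ n (Q : ℕ → Set) → Σ (Fin (suc n)) (λ i → Q (toℕ i)) ↔ (Σ (Fin n) (λ i → Q (toℕ i)) ⊎ Q n)
Σ-Fin-suc↔⊎ʳ zero Q = begin
  Σ (Fin 1) (λ i → Q (toℕ i))           ↔⟨ Σ-Fin-1↔ Q ⟩
  Q 0                                    ↔⟨ ⊎-identityʳ-¬ (λ { (() , _) }) ⟨
  (Q 0 ⊎ Σ (Fin 0) (λ i → Q (toℕ i)))   ↔⟨ ⊎-comm _ _ ⟩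
  (Σ (Fin 0) (λ i → Q (toℕ i)) ⊎ Q 0)   ∎
Σ-Fin-suc↔⊎ʳ (suc n) Q = begin
  Σ (Fin (suc (suc n))) (λ i → Q (toℕ i))
    ↔⟨ Σ-Fin-suc↔⊎ˡ Q ⟩
  (Q 0 ⊎ Σ (Fin (suc n)) (λ i → Q (suc (toℕ i))))
    ↔⟨ ↔-refl ⊎-↔ Σ-Fin-suc↔⊎ʳ n (Q ∘ suc) ⟩
  (Q 0 ⊎ (Σ (Fin n) (λ i → Q (suc (toℕ i))) ⊎ Q (suc n)))
    ↔⟨ ⊎-assoc 0ℓ _ _ _ ⟨
  ((Q 0 ⊎ Σ (Fin n) (λ i → Q (suc (toℕ i)))) ⊎ Q (suc n))
    ↔⟨ Σ-Fin-suc↔⊎ˡ Q ⊎-↔ ↔-refl ⟨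
  (Σ (Fin (suc n)) (λ i → Q (toℕ i)) ⊎ Q (suc n))
    ∎

parts : KTerm d n k → List ℕ
parts = proj₁ ∘ proj₁

parts-injective : (s t : KTerm d n k) → parts s ≡ parts t → s ≡ t
parts-injective ((μ , ds , Σμ) , ℓμ) ((.μ , ds′ , Σμ′) , ℓμ′) refl
  rewrite All.irrelevant ≤-irrelevant ds ds′ | ≡-irrelevant Σμ Σμ′ | ≡-irrelevant ℓμ ℓμ′ = refl

KTermsUpTo : ℕ → ℕ → ℕ → Set
KTermsUpTo d n k = Σ (Fin (suc n)) (λ i → KTerm d (toℕ i) k)

KTermsUpTo-≡ : {i j : Fin (suc n)} (s : KTerm d (toℕ i) k) (t : KTerm d (toℕ j) k) →
               i ≡ j → parts s ≡ parts t → _≡_ {A = KTermsUpTo d n k} (i , s) (j , t)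
KTermsUpTo-≡ s t refl = cong (_ ,_) ∘ parts-injective s t

IsComposition-∷⇒d≤n : ∀ {p μ} → IsComposition d n (p ∷ μ) → d ≤ n
IsComposition-∷⇒d≤n {p = p} {μ} (d≤p All.∷ _ , Σμ) = ≤-trans d≤p (≤-trans (m≤m+n p (sum μ)) (≤-reflexive Σμ))

KTerm-size-suc⇒d≤ : KTerm d (suc n) k → d ≤ suc n
KTerm-size-suc⇒d≤ (([] , _ , ()) , _)
KTerm-size-suc⇒d≤ ((_ ∷ _ , μ) , _) = IsComposition-∷⇒d≤n μ

KTerm-length-suc⇒d≤ : KTerm d n (suc k) → d ≤ n
KTerm-length-suc⇒d≤ ((_ ∷ _ , μ) , _) = IsComposition-∷⇒d≤n μ

¬KTerm-size-suc-length-zero : ¬ KTerm d (suc n) 0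
¬KTerm-size-suc-length-zero (([] , _ , ()) , _)

module _ {d m k : ℕ} (d≤m : d ≤ m) where

  -- The index is the remainder m ∸ p left after removing the first part p.
  KTerm-length-suc↔KTermsUpTo : KTerm d m (suc k) ↔ KTermsUpTo d (m ∸ d) k
  KTerm-length-suc↔KTermsUpTo = mk↔ₛ′ split join split∘join join∘split
    where
    remainder< : ∀ {p r} → d ≤ p → p + r ≡ m → r < suc (m ∸ d)
    remainder< {p} {r} d≤p p+r≡m =
      s≤s (m+n≤o⇒m≤o∸n r (≤-trans (+-monoʳ-≤ r d≤p) (≤-reflexive (trans (+-comm r p) p+r≡m))))

    split : KTerm d m (suc k) → KTermsUpTo d (m ∸ d) k
    split ((p ∷ μ , d≤p All.∷ ds , Σμ) , ℓμ) =
      fromℕ< r< , (μ , ds , sym (toℕ-fromℕ< r<)) , suc-injective ℓμ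
      where r< = remainder< d≤p Σμ

    module _ (i : Fin (suc (m ∸ d))) where
      i≤m∸d : toℕ i ≤ m ∸ d
      i≤m∸d = ≤-pred (toℕ<n i)

      i≤m : toℕ i ≤ m
      i≤m = ≤-trans i≤m∸d (m∸n≤m m d)

      d≤first : d ≤ m ∸ toℕ i
      d≤first = subst (_≤ m ∸ toℕ i) (m∸[m∸n]≡n d≤m) (∸-monoʳ-≤ m i≤m∸d)

    join : KTermsUpTo d (m ∸ d) k → KTerm d m (suc k)
    join (i , (μ , ds , Σμ) , ℓμ) =
      (m ∸ toℕ i ∷ μ , d≤first i All.∷ ds , trans (cong (m ∸ toℕ i +_) Σμ) (m∸n+n≡m (i≤m i))) , cong suc ℓμ

    split∘join : ∀ y → split (join y) ≡ y
    split∘join (i , (μ , _ , Σμ) , _) =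
      KTermsUpTo-≡ _ _ (toℕ-injective (trans (toℕ-fromℕ< _) Σμ)) refl

    join∘split : ∀ x → join (split x) ≡ x
    join∘split ((p ∷ μ , d≤p All.∷ _ , Σμ) , _) =
      parts-injective _ _ (cong (_∷ μ) (trans (cong (m ∸_) (toℕ-fromℕ< (remainder< d≤p Σμ))) m∸rest≡p))
      where
      m∸rest≡p : m ∸ sum μ ≡ p
      m∸rest≡p = trans (cong (_∸ sum μ) (sym Σμ)) (m+n∸n≡m p (sum μ))

<ᵇ≡false : d ≤ n → (n <ᵇ d) ≡ false
<ᵇ≡false d≤n = det (<ᵇ-reflects-< _ _) (ofⁿ (≤⇒≯ d≤n))

<ᵇ≡true : n < d → (n <ᵇ d) ≡ true
<ᵇ≡true n<d = det (<ᵇ-reflects-< _ _) (ofʸ n<d)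

F-≥ : ∀ k → d ≤ n → F d n k ≡ fibStep d n k false
F-≥ k = cong (fibStep _ _ k) ∘ <ᵇ≡false

F-< : ∀ k → n < d → F d n k ≡ fibStep d n k true
F-< k = cong (fibStep _ _ k) ∘ <ᵇ≡true

fibStep-true-≡ : ∀ k → fibStep d m k true ≡ fibStep d n k true
fibStep-true-≡ zero    = refl
fibStep-true-≡ (suc k) = refl

F-suc-below : ∀ k → suc n < d → F d (suc n) k ≡ F d n k
F-suc-below k 1+n<d = trans (F-< k 1+n<d) (trans (fibStep-true-≡ k) (sym (F-< k (<⇒≤ 1+n<d))))

F-suc-zero : d ≤ suc n → F d (suc n) 0 ≡ F d n 0
F-suc-zero = F-≥ 0

F-suc-suc : ∀ k → d ≤ suc n → F d (suc n) (suc k) ≡ F d n (suc k) + F d (suc n ∸ d) k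
F-suc-suc k = F-≥ (suc k)

Fin-1↔KTerm-zero-zero : Fin 1 ↔ KTerm d 0 0
Fin-1↔KTerm-zero-zero = mk↔ₛ′ (λ _ → ([] , All.[] , refl) , refl) (λ _ → Fin.zero)
  (λ { (([] , All.[] , refl) , refl) → refl }) (λ { Fin.zero → refl ; (Fin.suc ()) })

F-zero↔KTerm : ∀ d k → Fin (F d 0 k) ↔ KTerm d 0 k
F-zero↔KTerm zero    zero    = Fin-1↔KTerm-zero-zero
F-zero↔KTerm zero    (suc k) = begin
  Fin (F 0 0 (suc k))  ≡⟨ refl ⟩
  Fin (F 0 0 k)        ↔⟨ F-zero↔KTerm 0 k ⟩
  KTerm 0 0 k          ↔⟨ Σ-Fin-1↔ (λ i → KTerm 0 i k) ⟨
  KTermsUpTo 0 0 k     ↔⟨ KTerm-length-suc↔KTermsUpTo z≤n ⟨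
  KTerm 0 0 (suc k)    ∎
F-zero↔KTerm (suc d) zero    = Fin-1↔KTerm-zero-zero
F-zero↔KTerm (suc d) (suc k) = empty↔empty (λ ()) (n≮0 ∘ KTerm-length-suc⇒d≤)

module _ {d : ℕ} where
  mutual
    F-suc↔F⊎KTerm : ∀ n k → Fin (F d (suc n) k) ↔ (Fin (F d n k) ⊎ KTerm d (suc n) k)
    F-suc↔F⊎KTerm n k with d ≤? suc n
    F-suc↔F⊎KTerm n k       | no d≰1+n = begin
      Fin (F d (suc n) k)                  ≡⟨ cong Fin (F-suc-below k (≰⇒> d≰1+n)) ⟩
      Fin (F d n k)                        ↔⟨ ⊎-identityʳ-¬ (d≰1+n ∘ KTerm-size-suc⇒d≤) ⟨
      (Fin (F d n k) ⊎ KTerm d (suc n) k)  ∎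
    F-suc↔F⊎KTerm n zero    | yes d≤1+n = begin
      Fin (F d (suc n) 0)                  ≡⟨ cong Fin (F-suc-zero d≤1+n) ⟩
      Fin (F d n 0)                        ↔⟨ ⊎-identityʳ-¬ ¬KTerm-size-suc-length-zero ⟨
      (Fin (F d n 0) ⊎ KTerm d (suc n) 0)  ∎
    F-suc↔F⊎KTerm n (suc k) | yes d≤1+n = begin
      Fin (F d (suc n) (suc k))
        ≡⟨ cong Fin (F-suc-suc k d≤1+n) ⟩
      Fin (F d n (suc k) + F d (suc n ∸ d) k)
        ↔⟨ +↔⊎ ⟩
      (Fin (F d n (suc k)) ⊎ Fin (F d (suc n ∸ d) k))
        ↔⟨ ↔-refl ⊎-↔ F↔KTermsUpTo (suc n ∸ d) k ⟩
      (Fin (F d n (suc k)) ⊎ KTermsUpTo d (suc n ∸ d) k)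
        ↔⟨ ↔-refl ⊎-↔ KTerm-length-suc↔KTermsUpTo d≤1+n ⟨
      (Fin (F d n (suc k)) ⊎ KTerm d (suc n) (suc k))
        ∎

    F↔KTermsUpTo : ∀ n k → Fin (F d n k) ↔ KTermsUpTo d n k
    F↔KTermsUpTo zero    k = begin
      Fin (F d 0 k)     ↔⟨ F-zero↔KTerm d k ⟩
      KTerm d 0 k       ↔⟨ Σ-Fin-1↔ (λ i → KTerm d i k) ⟨
      KTermsUpTo d 0 k  ∎
    F↔KTermsUpTo (suc n) k = begin
      Fin (F d (suc n) k)                     ↔⟨ F-suc↔F⊎KTerm n k ⟩
      (Fin (F d n k) ⊎ KTerm d (suc n) k)     ↔⟨ F↔KTermsUpTo n k ⊎-↔ ↔-refl ⟩
      (KTermsUpTo d n k ⊎ KTerm d (suc n) k)  ↔⟨ Σ-Fin-suc↔⊎ʳ (suc n) (λ i → KTerm d i k) ⟨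
      KTermsUpTo d (suc n) k                  ∎

lemma4p2 : (d : ℕ) →
    ((n k : ℕ) → Fin (F d (suc n) k) ↔ (Fin (F d n k) ⊎ KTerm d (suc n) k))
    × ((n k : ℕ) → Fin (F d n k) ↔ Σ (Fin (suc n)) (λ i → KTerm d (toℕ i) k))
lemma4p2 d = F-suc↔F⊎KTerm , F↔KTermsUpTo
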